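{- Let $H$ be a plane graph whose interior faces $F_1,\dots,F_n$ are each bounded by a cycle, and let $G$ be its weak dual, with vertex set $\{v_1,\dots,v_n\}$, where $v_i$ corresponds to $F_i$. Let $c\in\mathbb{N}^n$ be given by $c_i=c(F_i)$, the length of the cycle bounding $F_i$. Then for every $k$, the ideal of $\mathbb{Z}$ obtained by evaluating the critical ideal $I_k(G)$ at $X=c$ is generated by $\Delta_k(C(H))$. Moreover, $f_1(C(H))\geq\gamma(G)$.
   Context: Weak dual $G_*$ of a plane graph: the dual graph (one vertex per face, one edge crossing each edge of the plane graph) with the vertex of the outer face deleted; it may have multiple edges. For a graph $G$ on $n$ vertices, $A(G)$ is its adjacency matrix, with $(i,j)$-entry the number of edges between $v_i$ and $v_j$. Set $A_X(G)=\operatorname{diag}(x_1,\dots,x_n)-A(G)$, with indeterminates $X=(x_1,\dots,x_n)$. The $k$-th critical ideal $I_k(G)\subseteq\mathbb{Z}[X]$ is the ideal generated by the $k\times k$ minors of $A_X(G)$, with the conventions $I_k=\langle 1\rangle$ for $k<1$ and $I_k=\langle 0\rangle$ for $k>n$. The algebraic co-rank $\gamma(G)$ is the number of critical ideals of $G$ equal to $\langle 1\rangle$. The cycle-intersection matrix $C(H)=(c_{ij})$ is the symmetric $n\times n$ integer matrix with $c_{ii}=c(F_i)$ and, for $i\neq j$, $c_{ij}=-$(number of edges common to the cycles bounding $F_i$ and $F_j$). For an integer matrix $M$, $\Delta_k(M)$ is the gcd of its $k\times k$ minors, and $f_1(M)$ is the number of invariant factors of $M$ (diagonal entries of its Smith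 normal form) equal to $1$. -}

module Defs where

open import Data.Nat as ℕ using (ℕ; zero; suc)
open import Data.Nat.GCD using (gcd)
open import Data.Integer as ℤ using (ℤ; +_; ∣_∣)
open import Data.Integer.Divisibility as ℤD using ()
open import Data.Fin using (Fin; zero; suc; punchIn; inject₁; fromℕ)
open import Data.Fin.Properties using (_≟_)
open import Data.Fin.Subset using (Subset)
open import Data.Bool using (Bool; true; false; if_then_else_; _∧_; _∨_)
open import Data.List using (List; []; _∷_; _++_; map; concat; foldr; zipWith)
open import Data.Vec using (Vec; []; _∷_; lookup)
import Data.Vec as Vec
open import Data.Product using (Σ; ∃; _×_; _,_)
open import Data.Sum using (_⊎_)
open import Function.Definitions using (Injective)
open import Relation.Binary.PropositionalEquality using (_≡_; _≢_)
open import Relation.Nullary.Decidable using (⌊_⌋)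

sumFin : {A : Set} → A → (A → A → A) → (n : ℕ) → (Fin n → A) → A
sumFin z _⊕_ zero    f = z
sumFin z _⊕_ (suc n) f = f zero ⊕ sumFin z _⊕_ n (λ i → f (suc i))

count : (m : ℕ) → (Fin m → Bool) → ℕ
count m p = sumFin 0 ℕ._+_ m (λ e → if p e then 1 else 0)

_=ᵇ_ : {n : ℕ} → Fin n → Fin n → Bool
a =ᵇ b = ⌊ a ≟ b ⌋

module Det {A : Set} (0# 1# : A) (_⊕_ _⊗_ : A → A → A) (⊖_ : A → A) where

  alt : ℕ → A → A
  alt zero    x = x
  alt (suc k) x = ⊖ (alt k x)

  det : (n : ℕ) → (Fin n → Fin n → A) → A
  det zero    M = 1#
  det (suc n) M =
    sumFin 0# _⊕_ (suc n) (λ j →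
      alt (Data.Fin.toℕ j)
        (M zero j ⊗ det n (λ r c → M (suc r) (punchIn j c))))

-- Strictly increasing index sequences (k-subsets of Fin n)

choose : (k n : ℕ) → List (Vec (Fin n) k)
choose zero    n       = [] ∷ []
choose (suc k) zero    = []
choose (suc k) (suc n) =
  map (λ v → zero ∷ Vec.map suc v) (choose k n) ++
  map (Vec.map suc) (choose (suc k) n)

submatrix : {A : Set} {n k : ℕ} → (Fin n → Fin n → A) →
            Vec (Fin n) k → Vec (Fin n) k → Fin k → Fin k → A
submatrix M rs cs a b = M (lookup rs a) (lookup cs b)

minors : {A : Set} (0# 1# : A) (_⊕_ _⊗_ : A → A → A) (⊖_ : A → A) →
         (n k : ℕ) → (Fin n → Fin n → A) → List A
minors 0# 1# _⊕_ _⊗_ ⊖_ n k M =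
  concat (map (λ rs → map (λ cs →
      Det.det 0# 1# _⊕_ _⊗_ ⊖_ k (submatrix M rs cs))
    (choose k n)) (choose k n))

Matℤ : ℕ → Set
Matℤ n = Fin n → Fin n → ℤ

minorsℤ : (n k : ℕ) → Matℤ n → List ℤ
minorsℤ = minors (+ 0) (+ 1) ℤ._+_ ℤ._*_ (λ a → ℤ.- a)

-- Δ_k(M) = gcd of the k × k minors (gcd of the empty family is 0)
Δ : {n : ℕ} → ℕ → Matℤ n → ℕ
Δ {n} k M = foldr (λ a r → gcd ∣ a ∣ r) 0 (minorsℤ n k M)

_·_ : {n : ℕ} → Matℤ n → Matℤ n → Matℤ n
_·_ {n} P Q i j = sumFin (+ 0) ℤ._+_ n (λ l → P i l ℤ.* Q l j)

Id : {n : ℕ} → Matℤ n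
Id i j = if i =ᵇ j then + 1 else + 0

IsInverse : {n : ℕ} → Matℤ n → Matℤ n → Set
IsInverse P P' = (∀ i j → (P · P') i j ≡ Id i j) × (∀ i j → (P' · P) i j ≡ Id i j)

-- D is in Smith normal form: diagonal, non-negative diagonal entries,
-- d₁ ∣ d₂ ∣ ⋯ ∣ dₙ (this forces the zero entries to come last).
IsSmithForm : {n : ℕ} → Matℤ n → Set
IsSmithForm {n} D =
  (∀ i j → i ≢ j → D i j ≡ + 0) ×
  (∀ i → ℤ.0ℤ ℤ.≤ D i i) ×
  (∀ (i : Fin n) (j : Fin n) → Data.Fin.toℕ j ≡ suc (Data.Fin.toℕ i) →
     D i i ℤD.∣ D j j)

IsSNFOf : {n : ℕ} → Matℤ n → Matℤ n → Set
IsSNFOf {n} D M =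
  Σ (Matℤ n) λ P → Σ (Matℤ n) λ P' → Σ (Matℤ n) λ Q → Σ (Matℤ n) λ Q' →
    IsInverse P P' × IsInverse Q Q' × IsSmithForm D ×
    (∀ i j → ((P · M) · Q) i j ≡ D i j)

f₁ : {n : ℕ} → Matℤ n → ℕ
f₁ {n} D = count n (λ i → ⌊ D i i ℤ.≟ + 1 ⌋)

-- Polynomials in ℤ[x₁,…,xₙ]; two polynomials are equal iff they agree
-- as functions ℤⁿ → ℤ (equivalent to coefficientwise equality, ℤ being
-- an infinite integral domain).

data Poly (n : ℕ) : Set where
  con  : ℤ → Poly n
  var  : Fin n → Poly n
  _⊕_  : Poly n → Poly n → Poly n
  _⊗_  : Poly n → Poly n → Poly n
  ⊖_   : Poly n → Poly n

eval : {n : ℕ} → (Fin n → ℤ) → Poly n → ℤ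
eval x (con a)  = a
eval x (var i)  = x i
eval x (p ⊕ q)  = eval x p ℤ.+ eval x q
eval x (p ⊗ q)  = eval x p ℤ.* eval x q
eval x (⊖ p)    = ℤ.- eval x p

_≈_ : {n : ℕ} → Poly n → Poly n → Set
p ≈ q = ∀ x → eval x p ≡ eval x q

lincomb : {n : ℕ} → List (Poly n) → List (Poly n) → Poly n
lincomb cs gs = foldr _⊕_ (con (+ 0)) (zipWith _⊗_ cs gs)

_∈Ideal_ : {n : ℕ} → Poly n → List (Poly n) → Set
p ∈Ideal gs = ∃ λ cs → p ≈ lincomb cs gs

-- Critical ideals of a multigraph on n vertices, given by its adjacency
-- matrix A (entries = edge multiplicities).

Lap : {n : ℕ} → (Fin n → Fin n → ℕ) → Fin n → Fin n → Poly n
Lap A i j = if i =ᵇ j then (var i ⊕ (⊖ con (+ A i j))) else (⊖ con (+ A i j))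

criticalGens : {n : ℕ} → (Fin n → Fin n → ℕ) → ℕ → List (Poly n)
criticalGens {n} A k = minors (con (+ 0)) (con (+ 1)) _⊕_ _⊗_ ⊖_ n k (Lap A)

_∈I[_]_ : {n : ℕ} → Poly n → ℕ → (Fin n → Fin n → ℕ) → Set
p ∈I[ k ] A = p ∈Ideal criticalGens A k

_∈Ieval[_,_]_ : {n : ℕ} → ℤ → ℕ → (Fin n → ℤ) → (Fin n → Fin n → ℕ) → Set
z ∈Ieval[ k , c ] A = ∃ λ p → (p ∈I[ k ] A) × (eval c p ≡ z)

IsTrivialIdeal : {n : ℕ} → ℕ → (Fin n → Fin n → ℕ) → Set
IsTrivialIdeal k A = con (+ 1) ∈I[ k ] A

-- H has V vertices and m edges; edge e joins the (unordered) endpoints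
-- ends e.  Faces are indexed by Fin (suc n): zero is the outer face,
-- suc i is the interior face F_{i+1}.  Each edge has two sides, and
-- side₁ e, side₂ e are the faces on them.

record Cycle (V m : ℕ) (ends : Fin m → Fin V × Fin V) : Set where
  field
    len      : ℕ                        -- length is suc len ≥ 1
    vs       : Fin (suc (suc len)) → Fin V   -- closed walk v₀ … v_L = v₀
    es       : Fin (suc len) → Fin m
    closed   : vs (fromℕ (suc len)) ≡ vs zero
    vs-inj   : Injective _≡_ _≡_ (λ (t : Fin (suc len)) → vs (inject₁ t))
    es-inj   : Injective _≡_ _≡_ es
    joins    : ∀ t → ends (es t) ≡ (vs (inject₁ t) , vs (suc t))
                   ⊎ ends (es t) ≡ (vs (suc t) , vs (inject₁ t))

record PlaneGraph (V m n : ℕ) : Set where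
  field
    ends  : Fin m → Fin V × Fin V
    side₁ : Fin m → Fin (suc n)
    side₂ : Fin m → Fin (suc n)

  onBoundary : Fin n → Fin m → Bool
  onBoundary i e = (side₁ e =ᵇ suc i) ∨ (side₂ e =ᵇ suc i)

  field
    -- an edge on the boundary of an interior face (a cycle) separates
    -- that face from a different face
    separating : ∀ e → side₁ e ≡ side₂ e → side₁ e ≡ zero
    boundaryCycle : ∀ i → Σ (Cycle V m ends) λ C →
      ∀ e → (onBoundary i e ≡ true → ∃ λ t → Cycle.es C t ≡ e) ×
            ((∃ λ t → Cycle.es C t ≡ e) → onBoundary i e ≡ true)

  -- c(F_i): length of the cycle bounding F_i (= number of its edges)
  faceLength : Fin n → ℕ
  faceLength i = count m (onBoundary i)

  common : Fin n → Fin n → ℕ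
  common i j = count m (λ e → onBoundary i e ∧ onBoundary j e)

  cycleIntersection : Matℤ n
  cycleIntersection i j =
    if i =ᵇ j then + faceLength i else ℤ.- (+ common i j)

  -- adjacency matrix of the weak dual G_*: one dual edge between the
  -- two faces on the sides of each edge of H; the outer-face vertex
  -- (zero) is deleted.
  weakDualAdj : Fin n → Fin n → ℕ
  weakDualAdj i j = count m (λ e →
    ((side₁ e =ᵇ suc i) ∧ (side₂ e =ᵇ suc j)) ∨
    ((side₁ e =ᵇ suc j) ∧ (side₂ e =ᵇ suc i)))

  cvec : Fin n → ℤ
  cvec i = + faceLength i

module Submission where

open import Defs
open import Data.Nat using (ℕ; suc; _≤_)
open import Data.Integer using (ℤ; +_)
open import Data.Integer.Divisibility using (_∣_)
open import Data.Fin using (Fin; toℕ)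
open import Data.Fin.Subset using (Subset; _∈_; ∣_∣)
open import Data.Product using (_×_)
open import Function.Bundles using (_⇔_)

-- The proof runs in three layers.
--  * Weak dual: an edge of H never has the same interior face on both
--    sides, so A has zero diagonal and A_ij counts the common boundary edges
--    of F_i and F_j; hence diag(X) − A evaluated at X = c is exactly C.
--  * Ideals: evaluation commutes with determinants, so the generators of
--    I_k(G) evaluate to the k × k minors of C, and the ideal of ℤ they
--    generate is ⟨gcd⟩ = ⟨Δ_k(C)⟩ (the gcd divides each minor, and Bézout
--    writes it as an integral combination).  This is the first claim.
--  * Smith form: from D = P C Q with P, Q invertible, C = P′ D Q′, and a
--    Cauchy–Binet expansion (the determinant is linear and alternating in
--    its rows) shows that d_i divides every (i+1)-minor of C.  If
--    I_{i+1}(G) = ⟨1⟩ the first layer gives Δ_{i+1}(C) = 1, hence d_i = 1.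
-- The file develops finite sums, determinants (linearity, alternation,
-- the Cauchy–Binet divisibility), matrix algebra and the Smith form, the
-- gcd of a list of integers, evaluation of critical ideals, the weak dual,
-- and finally the theorem.

open import Data.Bool using (Bool; true; false; T; if_then_else_; _∧_; _∨_)
open import Data.Empty using (⊥; ⊥-elim)
open import Data.Fin as F using (zero; suc; punchIn; punchOut)
import Data.Fin.Properties as FP
open import Data.Integer as ℤ using (_+_; _*_; -_; _-_)
import Data.Integer.Properties as ℤP
open import Data.Integer.Divisibility.Signed as ℤS using (divides)
  renaming (_∣_ to _∣ₛ_)
open import Data.Integer.Tactic.RingSolver using (solve-∀)
open import Data.List as List using (List; []; _∷_; foldr; zipWith)
import Data.List.Properties as LP
open import Data.List.Relation.Unary.All as All using (All; []; _∷_)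
import Data.List.Relation.Unary.All.Properties as AllP
open import Data.Nat as ℕ using (zero)
import Data.Nat.Divisibility as ℕD
open import Data.Nat.GCD using (gcd; gcd[m,n]∣m; gcd[m,n]∣n; gcd-greatest; gcd-GCD; module Bézout)
import Data.Nat.Properties as ℕP
open import Data.Product using (Σ; _,_)
open import Data.Unit using (tt)
open import Data.Vec as Vec using (lookup; here; there)
open import Data.Vec.Functional using (updateAt; tail)
open import Data.Vec.Functional.Properties
  using (updateAt-updates; updateAt-minimal; updateAt-commutes; map-updateAt-local)
open import Algebra.Properties.Semiring.Sum ℤP.+-*-semiring
  using (sum; sum-cong-≗; ∑-distrib-+; ∑-comm; *-distribˡ-sum; *-distribʳ-sum;
         sum-remove; sum-replicate-zero)
open import Function using (_∘_; const)
open import Function.Bundles using (mk⇔; module Equivalence)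
open import Level using (0ℓ)
open import Relation.Binary.Bundles using (Setoid)
open import Relation.Binary.PropositionalEquality
import Relation.Binary.Reasoning.Setoid as SetoidReasoning
open import Relation.Nullary using (Dec; yes; no)
open import Relation.Nullary.Decidable using (⌊_⌋; dec-true; dec-false; isYes≗does; toWitness)

sumFin≡sum : ∀ n (f : Fin n → ℤ) → sumFin (+ 0) _+_ n f ≡ sum f
sumFin≡sum zero    f = refl
sumFin≡sum (suc n) f = cong (λ s → f zero + s) (sumFin≡sum n (f ∘ suc))

sum-neg : ∀ {n} (f : Fin n → ℤ) → - sum f ≡ sum (λ i → - f i)
sum-neg f = begin
  - sum f                 ≡⟨ ℤP.-1*i≡-i (sum f) ⟨
  ℤ.-1ℤ * sum f           ≡⟨ *-distribˡ-sum ℤ.-1ℤ f ⟩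
  sum (λ i → ℤ.-1ℤ * f i) ≡⟨ sum-cong-≗ (ℤP.-1*i≡-i ∘ f) ⟩
  sum (λ i → - f i)       ∎
  where open ≡-Reasoning

sum-single : ∀ {n} (f : Fin n → ℤ) (j : Fin n) → (∀ l → l ≢ j → f l ≡ + 0) →
             sum f ≡ f j
sum-single {suc n} f j off = begin
  sum f                      ≡⟨ sum-remove {i = j} f ⟩
  f j + sum (f ∘ punchIn j)  ≡⟨ cong (λ s → f j + s) (trans (sum-cong-≗ offⱼ) (sum-replicate-zero n)) ⟩
  f j + + 0                  ≡⟨ ℤP.+-identityʳ (f j) ⟩
  f j                        ∎
  where
  open ≡-Reasoning
  offⱼ : ∀ c → f (punchIn j c) ≡ + 0
  offⱼ c = off (punchIn j c) (FP.punchInᵢ≢i j c)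

module Detℤ = Det (+ 0) (+ 1) _+_ _*_ -_

det : (k : ℕ) → Matℤ k → ℤ
det = Detℤ.det

sign : ℕ → ℤ
sign zero    = + 1
sign (suc k) = - sign k

alt≡sign* : ∀ k x → Detℤ.alt k x ≡ sign k * x
alt≡sign* zero    x = sym (ℤP.*-identityˡ x)
alt≡sign* (suc k) x = trans (cong -_ (alt≡sign* k x)) (ℤP.neg-distribˡ-* (sign k) x)

minor : ∀ {k} → Matℤ (suc k) → Fin (suc k) → Matℤ k
minor M j r c = M (suc r) (punchIn j c)

det-expand : ∀ k (M : Matℤ (suc k)) →
  det (suc k) M ≡ sum (λ j → sign (toℕ j) * (M zero j * det k (minor M j)))
det-expand k M = trans (sumFin≡sum (suc k) (λ j → Detℤ.alt (toℕ j) (M zero j * det k (minor M j))))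
  (sum-cong-≗ (λ j → alt≡sign* (toℕ j) (M zero j * det k (minor M j))))

infix 4 _≋_
_≋_ : ∀ {k} → Matℤ k → Matℤ k → Set
M ≋ N = ∀ r c → M r c ≡ N r c

det-cong : ∀ k {M N : Matℤ k} → M ≋ N → det k M ≡ det k N
det-cong zero    M≋N = refl
det-cong (suc k) {M} {N} M≋N = begin
  det (suc k) M                                              ≡⟨ det-expand k M ⟩
  sum (λ j → sign (toℕ j) * (M zero j * det k (minor M j)))  ≡⟨ sum-cong-≗ term ⟩
  sum (λ j → sign (toℕ j) * (N zero j * det k (minor N j)))  ≡⟨ det-expand k N ⟨
  det (suc k) N                                              ∎
  where
  open ≡-Reasoning
  term : ∀ j → sign (toℕ j) * (M zero j * det k (minor M j))
             ≡ sign (toℕ j) * (N zero j * det k (minor N j))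
  term j = cong (sign (toℕ j) *_)
    (cong₂ _*_ (M≋N zero j) (det-cong k (λ r c → M≋N (suc r) (punchIn j c))))

-- Linear functionals on rows.  The determinant is linear in each row;
-- we record this as a property of the functional w ↦ det (M with row r := w).

Row : ℕ → Set
Row k = Fin k → ℤ

_⊞_ : ∀ {k} → Row k → Row k → Row k
(u ⊞ v) b = u b + v b

_⊡_ : ∀ {k} → ℤ → Row k → Row k
(t ⊡ u) b = t * u b

record IsLinear {k} (φ : Row k → ℤ) : Set where
  field
    additive    : ∀ u v → φ (u ⊞ v) ≡ φ u + φ v
    homogeneous : ∀ t u → φ (t ⊡ u) ≡ t * φ u

open IsLinear

linear-cong : ∀ {k} {φ ψ : Row k → ℤ} → (∀ w → φ w ≡ ψ w) → IsLinear φ → IsLinear ψ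
linear-cong φ≗ψ L .additive u v =
  trans (sym (φ≗ψ (u ⊞ v))) (trans (L .additive u v) (cong₂ _+_ (φ≗ψ u) (φ≗ψ v)))
linear-cong φ≗ψ L .homogeneous t u =
  trans (sym (φ≗ψ (t ⊡ u))) (trans (L .homogeneous t u) (cong (t *_) (φ≗ψ u)))

linear-coord : ∀ {k} (b : Fin k) → IsLinear (λ w → w b)
linear-coord b .additive u v    = refl
linear-coord b .homogeneous t u = refl

linear-scale : ∀ {k} {φ : Row k → ℤ} c → IsLinear φ → IsLinear (λ w → c * φ w)
linear-scale {φ = φ} c L .additive u v =
  trans (cong (c *_) (L .additive u v)) (ℤP.*-distribˡ-+ c (φ u) (φ v))
linear-scale {φ = φ} c L .homogeneous t u =
  trans (cong (c *_) (L .homogeneous t u)) (swap c t (φ u))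
  where swap : ∀ c t x → c * (t * x) ≡ t * (c * x)
        swap = solve-∀

linear-reindex : ∀ {k m} {φ : Row k → ℤ} (g : Fin k → Fin m) →
                 IsLinear φ → IsLinear (λ (w : Row m) → φ (w ∘ g))
linear-reindex g L .additive u v    = L .additive (u ∘ g) (v ∘ g)
linear-reindex g L .homogeneous t u = L .homogeneous t (u ∘ g)

linear-sum : ∀ {k n} (φ : Fin n → Row k → ℤ) → (∀ j → IsLinear (φ j)) →
             IsLinear (λ w → sum (λ j → φ j w))
linear-sum φ L .additive u v = trans (sum-cong-≗ (λ j → L j .additive u v))
  (∑-distrib-+ (λ j → φ j u) (λ j → φ j v))
linear-sum φ L .homogeneous t u = trans (sum-cong-≗ (λ j → L j .homogeneous t u))
  (sym (*-distribˡ-sum t (λ j → φ j u)))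

linear-∣ : ∀ {k n} {φ : Row k → ℤ} → IsLinear φ → ∀ d (c : Fin n → ℤ) (w : Fin n → Row k) →
           (∀ l → d ∣ₛ φ (w l)) → d ∣ₛ φ (λ b → sum (λ l → c l * w l b))
linear-∣ {n = zero} {φ} L d c w d∣ =
  divides (+ 0) (L .homogeneous (+ 0) (λ _ → + 0))
linear-∣ {n = suc n} {φ} L d c w d∣ = subst (d ∣ₛ_) (sym (L .additive _ _))
  (ℤS.∣m∣n⇒∣m+n
    (subst (d ∣ₛ_) (sym (L .homogeneous (c zero) (w zero))) (ℤS.∣n⇒∣m*n (c zero) (d∣ zero)))
    (linear-∣ L d (c ∘ suc) (w ∘ suc) (d∣ ∘ suc)))

setRow : ∀ {k} → Matℤ k → Fin k → Row k → Matℤ k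
setRow M r w = updateAt M r (const w)

setRow-same : ∀ {k} (M : Matℤ k) r w → setRow M r w r ≡ w
setRow-same M r w = updateAt-updates r M

setRow-other : ∀ {k} (M : Matℤ k) {r a} w → a ≢ r → setRow M r w a ≡ M a
setRow-other M {r} {a} w a≢r = updateAt-minimal a r M a≢r

minor-setRow : ∀ {k} (M : Matℤ (suc k)) r w j →
  minor (setRow M (suc r) w) j ≋ setRow (minor M j) r (w ∘ punchIn j)
minor-setRow M r w j rr c =
  cong-app (map-updateAt-local {f = _∘ punchIn j} {g = const w} (tail M) r refl rr) c

-- The determinant is linear in each row: along the first row by the
-- expansion, along a lower row since every minor is linear in it.
det-linear : ∀ k (M : Matℤ k) r → IsLinear (λ w → det k (setRow M r w))
det-linear (suc k) M zero = linear-cong (λ w → sym (det-expand k (setRow M zero w)))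
  (linear-sum _ (λ j → linear-cong (reorder j)
    (linear-scale (sign (toℕ j) * det k (minor M j)) (linear-coord j))))
  where reorder : ∀ j w → (sign (toℕ j) * det k (minor M j)) * w j
                        ≡ sign (toℕ j) * (w j * det k (minor M j))
        reorder j w = lem (sign (toℕ j)) (det k (minor M j)) (w j)
          where lem : ∀ s m x → (s * m) * x ≡ s * (x * m)
                lem = solve-∀
det-linear (suc k) M (suc r) = linear-cong (λ w → sym (expand w))
  (linear-sum _ (λ j → linear-scale (sign (toℕ j)) (linear-scale (M zero j)
     (linear-reindex (punchIn j) (det-linear k (minor M j) r)))))
  where
  expand : ∀ w → det (suc k) (setRow M (suc r) w)
    ≡ sum (λ j → sign (toℕ j) * (M zero j * det k (setRow (minor M j) r (w ∘ punchIn j))))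
  expand w = trans (det-expand k (setRow M (suc r) w)) (sum-cong-≗ (λ j →
    cong (λ x → sign (toℕ j) * (M zero j * x)) (det-cong k (minor-setRow M r w j))))

det-row-∣ : ∀ k (M : Matℤ k) r d → (∀ b → d ∣ₛ M r b) → d ∣ₛ det k M
det-row-∣ k M r d d∣ = divides (det k (setRow M r q)) (begin
  det k M                       ≡⟨ det-cong k rows ⟩
  det k (setRow M r (d ⊡ q))    ≡⟨ det-linear k M r .homogeneous d q ⟩
  d * det k (setRow M r q)      ≡⟨ ℤP.*-comm d _ ⟩
  det k (setRow M r q) * d      ∎)
  where
  open ≡-Reasoning
  q : Row k
  q b = ℤS.quotient (d∣ b)
  rows : M ≋ setRow M r (d ⊡ q)
  rows a c with a FP.≟ r
  ... | yes refl = trans (ℤS._∣_.equality (d∣ c))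
                     (trans (ℤP.*-comm (q c) d) (sym (cong-app (setRow-same M a (d ⊡ q)) c)))
  ... | no a≢r   = sym (cong-app (setRow-other M (d ⊡ q) a≢r) c)

-- Alternation.  Deleting two distinct columns a, b in either order leaves
-- the same columns, and the accompanying signs differ by -1.

punchIn-punchOut-swap : ∀ {K} (a b : Fin (suc (suc K))) (a≢b : a ≢ b) (b≢a : b ≢ a) c →
  punchIn a (punchIn (punchOut a≢b) c) ≡ punchIn b (punchIn (punchOut b≢a) c)
punchIn-punchOut-swap zero    zero    a≢b b≢a c = ⊥-elim (a≢b refl)
punchIn-punchOut-swap zero    (suc b) a≢b b≢a c = refl
punchIn-punchOut-swap (suc a) zero    a≢b b≢a c = refl
punchIn-punchOut-swap {suc K} (suc a) (suc b) a≢b b≢a zero    = refl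
punchIn-punchOut-swap {suc K} (suc a) (suc b) a≢b b≢a (suc c) =
  cong suc (punchIn-punchOut-swap a b (a≢b ∘ cong suc) (b≢a ∘ cong suc) c)

sign-punchOut-swap : ∀ {K} (a b : Fin (suc (suc K))) (a≢b : a ≢ b) (b≢a : b ≢ a) →
  sign (toℕ a) * sign (toℕ (punchOut a≢b)) ≡ - (sign (toℕ b) * sign (toℕ (punchOut b≢a)))
sign-punchOut-swap zero    zero    a≢b b≢a = ⊥-elim (a≢b refl)
sign-punchOut-swap zero    (suc b) a≢b b≢a = lem (sign (toℕ b))
  where lem : ∀ x → + 1 * x ≡ - ((- x) * + 1)
        lem = solve-∀
sign-punchOut-swap (suc a) zero    a≢b b≢a = lem (sign (toℕ a))
  where lem : ∀ x → (- x) * + 1 ≡ - (+ 1 * x)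
        lem = solve-∀
sign-punchOut-swap {zero}  (suc zero) (suc zero) a≢b b≢a = ⊥-elim (a≢b refl)
sign-punchOut-swap {suc K} (suc a)    (suc b)    a≢b b≢a =
  lem (sign (toℕ a)) (sign (toℕ (punchOut (a≢b ∘ cong suc))))
      (sign (toℕ b)) (sign (toℕ (punchOut (b≢a ∘ cong suc))))
      (sign-punchOut-swap a b (a≢b ∘ cong suc) (b≢a ∘ cong suc))
  where lem : ∀ x y z w → x * y ≡ - (z * w) → (- x) * (- y) ≡ - ((- z) * (- w))
        lem x y z w eq = trans (neg² x y) (trans eq (cong -_ (sym (neg² z w))))
          where neg² : ∀ x y → (- x) * (- y) ≡ x * y
                neg² = solve-∀

self-neg⇒0 : ∀ x → x ≡ - x → x ≡ + 0
self-neg⇒0 (+ zero)    _  = refl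
self-neg⇒0 (+ suc n)   ()
self-neg⇒0 ℤ.-[1+ n ]  ()

-- A matrix whose first two rows agree has determinant 0: expanding along
-- both rows writes det M as a double sum over ordered pairs of distinct
-- columns whose terms are antisymmetric under exchanging the pair.
module FirstRowsEqual (k : ℕ) (M : Matℤ (suc (suc k)))
                      (same : ∀ c → M zero c ≡ M (suc zero) c) where

  n₂ : ℕ
  n₂ = suc (suc k)

  u : Row n₂
  u = M zero

  E : Fin n₂ → Fin (suc k) → ℤ
  E a j = det k (minor (minor M a) j)

  term : Fin n₂ → Fin (suc k) → ℤ
  term a j = sign (toℕ a) * sign (toℕ j) * (u a * u (punchIn a j)) * E a j

  det≡Σterm : det n₂ M ≡ sum (λ a → sum (term a))
  det≡Σterm = trans (det-expand (suc k) M) (sum-cong-≗ row)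
    where
    row : ∀ a → sign (toℕ a) * (u a * det (suc k) (minor M a)) ≡ sum (term a)
    row a = begin
      sign (toℕ a) * (u a * det (suc k) (minor M a))
        ≡⟨ cong (λ x → sign (toℕ a) * (u a * x)) (det-expand k (minor M a)) ⟩
      sign (toℕ a) * (u a * sum (λ j → sign (toℕ j) * (M (suc zero) (punchIn a j) * E a j)))
        ≡⟨ cong (λ x → sign (toℕ a) * (u a * x)) (sum-cong-≗ (λ j →
             cong (λ x → sign (toℕ j) * (x * E a j)) (sym (same (punchIn a j))))) ⟩
      sign (toℕ a) * (u a * sum (inner a))
        ≡⟨ cong (sign (toℕ a) *_) (*-distribˡ-sum (u a) (inner a)) ⟩
      sign (toℕ a) * sum (λ j → u a * inner a j)
        ≡⟨ *-distribˡ-sum (sign (toℕ a)) (λ j → u a * inner a j) ⟩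
      sum (λ j → sign (toℕ a) * (u a * inner a j))
        ≡⟨ sum-cong-≗ (λ j → reorder (sign (toℕ a)) (u a) (sign (toℕ j)) (u (punchIn a j)) (E a j)) ⟩
      sum (term a) ∎
      where open ≡-Reasoning
            inner : Fin n₂ → Fin (suc k) → ℤ
            inner a j = sign (toℕ j) * (u (punchIn a j) * E a j)
            reorder : ∀ s x t y e → s * (x * (t * (y * e))) ≡ s * t * (x * y) * e
            reorder = solve-∀

  pairTerm′ : (a b : Fin n₂) → Dec (a ≡ b) → ℤ
  pairTerm′ a b (yes _)   = + 0
  pairTerm′ a b (no a≢b)  = term a (punchOut a≢b)

  pairTerm : Fin n₂ → Fin n₂ → ℤ
  pairTerm a b = pairTerm′ a b (a FP.≟ b)

  pairTerm-diag : ∀ a → pairTerm a a ≡ + 0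
  pairTerm-diag a with a FP.≟ a
  ... | yes _   = refl
  ... | no a≢a  = ⊥-elim (a≢a refl)

  pairTerm-punchIn : ∀ a j → pairTerm a (punchIn a j) ≡ term a j
  pairTerm-punchIn a j with a FP.≟ punchIn a j
  ... | yes a≡ = ⊥-elim (FP.punchInᵢ≢i a j (sym a≡))
  ... | no a≢  = cong (term a) (trans (FP.punchOut-cong a refl) (FP.punchOut-punchIn a))

  term-antisym : ∀ a b (a≢b : a ≢ b) (b≢a : b ≢ a) →
                 term b (punchOut b≢a) ≡ - term a (punchOut a≢b)
  term-antisym a b a≢b b≢a = begin
    term b (punchOut b≢a)
      ≡⟨ cong₂ (λ x y → sign (toℕ b) * sign (toℕ (punchOut b≢a)) * (u b * u x) * y)
           (FP.punchIn-punchOut b≢a)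
           (det-cong k (λ r c → cong (M (suc (suc r))) (sym (punchIn-punchOut-swap a b a≢b b≢a c)))) ⟩
    sign (toℕ b) * sign (toℕ (punchOut b≢a)) * (u b * u a) * e
      ≡⟨ cong (λ s → s * (u b * u a) * e) (sign-punchOut-swap b a b≢a a≢b) ⟩
    - (sign (toℕ a) * sign (toℕ (punchOut a≢b))) * (u b * u a) * e
      ≡⟨ reorder (sign (toℕ a) * sign (toℕ (punchOut a≢b))) (u a) (u b) e ⟩
    - (sign (toℕ a) * sign (toℕ (punchOut a≢b)) * (u a * u b) * e)
      ≡⟨ cong (λ x → - (sign (toℕ a) * sign (toℕ (punchOut a≢b)) * (u a * u x) * e))
           (sym (FP.punchIn-punchOut a≢b)) ⟩
    - term a (punchOut a≢b) ∎
    where open ≡-Reasoning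
          e : ℤ
          e = det k (minor (minor M a) (punchOut a≢b))
          reorder : ∀ s x y e → (- s) * (y * x) * e ≡ - (s * (x * y) * e)
          reorder = solve-∀

  pairTerm-antisym : ∀ a b → pairTerm b a ≡ - pairTerm a b
  pairTerm-antisym a b with a FP.≟ b | b FP.≟ a
  ... | yes _   | yes _   = refl
  ... | yes a≡b | no b≢a  = ⊥-elim (b≢a (sym a≡b))
  ... | no a≢b  | yes b≡a = ⊥-elim (a≢b (sym b≡a))
  ... | no a≢b  | no b≢a  = term-antisym a b a≢b b≢a

  total : ℤ
  total = sum (λ a → sum (pairTerm a))

  total≡Σterm : total ≡ sum (λ a → sum (term a))
  total≡Σterm = sum-cong-≗ (λ a → begin
    sum (pairTerm a)                             ≡⟨ sum-remove {i = a} (pairTerm a) ⟩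
    pairTerm a a + sum (pairTerm a ∘ punchIn a)
      ≡⟨ cong₂ _+_ (pairTerm-diag a) (sum-cong-≗ (pairTerm-punchIn a)) ⟩
    + 0 + sum (term a)                           ≡⟨ ℤP.+-identityˡ _ ⟩
    sum (term a)                                 ∎)
    where open ≡-Reasoning

  total-self-neg : total ≡ - total
  total-self-neg = begin
    sum (λ a → sum (pairTerm a))              ≡⟨ ∑-comm pairTerm ⟩
    sum (λ b → sum (λ a → pairTerm a b))      ≡⟨ sum-cong-≗ (λ b → sum-cong-≗ (λ a → flip a b)) ⟩
    sum (λ b → sum (λ a → - pairTerm b a))    ≡⟨ sum-cong-≗ (λ b → sum-neg (pairTerm b)) ⟨
    sum (λ b → - sum (pairTerm b))            ≡⟨ sum-neg (λ b → sum (pairTerm b)) ⟨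
    - total                                   ∎
    where open ≡-Reasoning
          flip : ∀ a b → pairTerm a b ≡ - pairTerm b a
          flip a b = trans (sym (ℤP.neg-involutive (pairTerm a b))) (cong -_ (sym (pairTerm-antisym a b)))

  det≡0 : det n₂ M ≡ + 0
  det≡0 = trans det≡Σterm (trans (sym total≡Σterm) (self-neg⇒0 total total-self-neg))

-- Two equal adjacent rows force the determinant to vanish: for rows 0, 1
-- this is FirstRowsEqual, otherwise every minor of the first-row expansion
-- still has two equal adjacent rows.
det-adjacent-equal : ∀ n (M : Matℤ n) (a b : Fin n) → toℕ b ≡ suc (toℕ a) →
                     (∀ c → M a c ≡ M b c) → det n M ≡ + 0
det-adjacent-equal (suc (suc k)) M zero (suc zero) _ same = FirstRowsEqual.det≡0 k M same
det-adjacent-equal (suc k) M (suc a) (suc b) b≡a+1 same = begin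
  det (suc k) M                                              ≡⟨ det-expand k M ⟩
  sum (λ j → sign (toℕ j) * (M zero j * det k (minor M j)))  ≡⟨ sum-cong-≗ vanish ⟩
  sum {suc k} (λ _ → + 0)                                    ≡⟨ sum-replicate-zero (suc k) ⟩
  + 0                                                        ∎
  where
  open ≡-Reasoning
  vanish : ∀ j → sign (toℕ j) * (M zero j * det k (minor M j)) ≡ + 0
  vanish j = begin
    sign (toℕ j) * (M zero j * det k (minor M j))
      ≡⟨ cong (λ x → sign (toℕ j) * (M zero j * x))
           (det-adjacent-equal k (minor M j) a b (ℕP.suc-injective b≡a+1) (same ∘ punchIn j)) ⟩
    sign (toℕ j) * (M zero j * + 0)  ≡⟨ cong (sign (toℕ j) *_) (ℤP.*-zeroʳ (M zero j)) ⟩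
    sign (toℕ j) * + 0               ≡⟨ ℤP.*-zeroʳ (sign (toℕ j)) ⟩
    + 0                              ∎
det-adjacent-equal _ M zero    zero              () same
det-adjacent-equal _ M zero    (suc (suc b))     () same
det-adjacent-equal _ M (suc a) zero              () same

alternating⇒antisymmetric : ∀ {X : Set} (_∙_ : X → X → X) (f : X → X → ℤ) →
  (∀ x y z → f (x ∙ y) z ≡ f x z + f y z) →
  (∀ x y z → f x (y ∙ z) ≡ f x y + f x z) →
  (∀ x → f x x ≡ + 0) → ∀ u v → f v u ≡ - f u v
alternating⇒antisymmetric _∙_ f addˡ addʳ diag u v = begin
  f v u                     ≡⟨ cancel (f u v) (f v u) ⟩
  (f u v + f v u) - f u v   ≡⟨ cong (λ x → x - f u v) sum≡0 ⟩
  + 0 - f u v               ≡⟨ ℤP.+-identityˡ (- f u v) ⟩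
  - f u v                   ∎
  where
  open ≡-Reasoning
  cancel : ∀ p q → q ≡ (p + q) - p
  cancel = solve-∀
  pad : ∀ p q → p + q ≡ (+ 0 + p) + (q + + 0)
  pad = solve-∀
  sum≡0 : f u v + f v u ≡ + 0
  sum≡0 = begin
    f u v + f v u                      ≡⟨ pad (f u v) (f v u) ⟩
    (+ 0 + f u v) + (f v u + + 0)      ≡⟨ cong₂ (λ p q → (p + f u v) + (f v u + q)) (diag u) (diag v) ⟨
    (f u u + f u v) + (f v u + f v v)  ≡⟨ cong₂ _+_ (addʳ u u v) (addʳ v u v) ⟨
    f u (u ∙ v) + f v (u ∙ v)          ≡⟨ addˡ u v (u ∙ v) ⟨
    f (u ∙ v) (u ∙ v)                  ≡⟨ diag (u ∙ v) ⟩
    + 0                                ∎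

swapRows : ∀ {k} → Matℤ k → Fin k → Fin k → Matℤ k
swapRows M a b = setRow (setRow M a (M b)) b (M a)

det-adjacent-swap : ∀ n (M : Matℤ n) (a b : Fin n) → toℕ b ≡ suc (toℕ a) →
                    det n (swapRows M a b) ≡ - det n M
det-adjacent-swap n M a b b≡a+1 = begin
  f (M b) (M a)   ≡⟨ alternating⇒antisymmetric _⊞_ f addˡ addʳ diag (M a) (M b) ⟩
  - f (M a) (M b) ≡⟨ cong -_ (det-cong n unchanged) ⟩
  - det n M       ∎
  where
  open ≡-Reasoning
  a≢b : a ≢ b
  a≢b a≡b = ℕP.1+n≢n (sym (trans (cong toℕ a≡b) b≡a+1))
  f : Row n → Row n → ℤ
  f x y = det n (setRow (setRow M a x) b y)
  addʳ : ∀ x y z → f x (y ⊞ z) ≡ f x y + f x z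
  addʳ x = det-linear n (setRow M a x) b .additive
  commute : ∀ x y → setRow (setRow M a x) b y ≋ setRow (setRow M b y) a x
  commute x y r = cong-app (updateAt-commutes b a (a≢b ∘ sym) M r)
  addˡ : ∀ x y z → f (x ⊞ y) z ≡ f x z + f y z
  addˡ x y z = begin
    f (x ⊞ y) z                                            ≡⟨ det-cong n (commute (x ⊞ y) z) ⟩
    det n (setRow (setRow M b z) a (x ⊞ y))                ≡⟨ det-linear n (setRow M b z) a .additive x y ⟩
    det n (setRow (setRow M b z) a x) + det n (setRow (setRow M b z) a y)
      ≡⟨ sym (cong₂ _+_ (det-cong n (commute x z)) (det-cong n (commute y z))) ⟩
    f x z + f y z                                          ∎
  diag : ∀ x → f x x ≡ + 0
  diag x = det-adjacent-equal n (setRow (setRow M a x) b x) a b b≡a+1 (λ c → cong-app (begin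
    setRow (setRow M a x) b x a   ≡⟨ setRow-other (setRow M a x) x a≢b ⟩
    setRow M a x a                ≡⟨ setRow-same M a x ⟩
    x                             ≡⟨ setRow-same (setRow M a x) b x ⟨
    setRow (setRow M a x) b x b   ∎) c)
  unchanged : setRow (setRow M a (M a)) b (M b) ≋ M
  unchanged r c with r FP.≟ b | r FP.≟ a
  ... | yes refl | _        = cong-app (setRow-same (setRow M a (M a)) r (M b)) c
  ... | no r≢b   | yes refl = trans (cong-app (setRow-other (setRow M r (M r)) (M b) r≢b) c)
                                    (cong-app (setRow-same M r (M r)) c)
  ... | no r≢b   | no r≢a   = trans (cong-app (setRow-other (setRow M a (M a)) (M b) r≢b) c)
                                    (cong-app (setRow-other M (M a) r≢a) c)

-- Two equal rows force the determinant to vanish.  Induction on the gap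
-- t between them: exchange the lower row with its upper neighbour b′.
det-equal-rows-gap : ∀ t n (M : Matℤ n) (a b : Fin n) → toℕ b ≡ suc (t ℕ.+ toℕ a) →
                     (∀ c → M a c ≡ M b c) → det n M ≡ + 0
det-equal-rows-gap zero    n M a b gap same = det-adjacent-equal n M a b gap same
det-equal-rows-gap (suc t) n M a b gap same = begin
  det n M                     ≡⟨ ℤP.neg-involutive (det n M) ⟨
  - - det n M                 ≡⟨ cong -_ (det-adjacent-swap n M b′ b b≡b′+1) ⟨
  - det n (swapRows M b′ b)   ≡⟨ cong -_ (det-equal-rows-gap t n (swapRows M b′ b) a b′ b′-gap rows) ⟩
  + 0                         ∎
  where
  open ≡-Reasoning
  b′<n : suc (t ℕ.+ toℕ a) ℕ.< n
  b′<n = ℕP.<-trans (subst (suc (t ℕ.+ toℕ a) ℕ.<_) (sym gap) (ℕP.n<1+n _)) (FP.toℕ<n b)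
  b′ : Fin n
  b′ = F.fromℕ< b′<n
  b′-gap : toℕ b′ ≡ suc (t ℕ.+ toℕ a)
  b′-gap = FP.toℕ-fromℕ< b′<n
  b≡b′+1 : toℕ b ≡ suc (toℕ b′)
  b≡b′+1 = trans gap (cong suc (sym b′-gap))
  a≢b : a ≢ b
  a≢b a≡b = ℕP.m≢1+n+m (toℕ a) (trans (cong toℕ a≡b) gap)
  a≢b′ : a ≢ b′
  a≢b′ a≡b′ = ℕP.m≢1+n+m (toℕ a) (trans (cong toℕ a≡b′) b′-gap)
  b′≢b : b′ ≢ b
  b′≢b b′≡b = ℕP.1+n≢n (trans (sym b≡b′+1) (cong toℕ (sym b′≡b)))
  rows : ∀ c → swapRows M b′ b a c ≡ swapRows M b′ b b′ c
  rows c = begin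
    swapRows M b′ b a c       ≡⟨ cong-app (setRow-other (setRow M b′ (M b)) (M b′) a≢b) c ⟩
    setRow M b′ (M b) a c     ≡⟨ cong-app (setRow-other M (M b) a≢b′) c ⟩
    M a c                     ≡⟨ same c ⟩
    M b c                     ≡⟨ cong-app (setRow-same M b′ (M b)) c ⟨
    setRow M b′ (M b) b′ c    ≡⟨ cong-app (setRow-other (setRow M b′ (M b)) (M b′) b′≢b) c ⟨
    swapRows M b′ b b′ c      ∎

det-equal-rows : ∀ n (M : Matℤ n) (a b : Fin n) → a F.< b →
                 (∀ c → M a c ≡ M b c) → det n M ≡ + 0
det-equal-rows n M a b a<b = det-equal-rows-gap (toℕ b ℕ.∸ suc (toℕ a)) n M a b gap
  where gap : toℕ b ≡ suc (toℕ b ℕ.∸ suc (toℕ a) ℕ.+ toℕ a)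
        gap = trans (sym (ℕP.m+[n∸m]≡n a<b)) (cong suc (ℕP.+-comm (toℕ a) _))

det-few-rows : ∀ {k m} → m ℕ.< k → (f : Fin k → Fin m) (R : Fin m → Row k) →
               det k (R ∘ f) ≡ + 0
det-few-rows {k} m<k f R with FP.pigeonhole m<k f
... | a , b , a<b , fa≡fb = det-equal-rows k (R ∘ f) a b a<b (λ c → cong (λ x → R x c) fa≡fb)

-- The rows of A·R are
-- integral combinations of rows of R; expanding them one at a time by
-- linearity writes det (A·R) as a combination of determinants of matrices
-- whose rows are rows of R.

select : ∀ {P A : Set} → Dec P → A → A → A
select (yes _) x y = x
select (no _)  x y = y

splice : ∀ {k} → ℕ → Matℤ k → Matℤ k → Matℤ k
splice j X Y a = select (toℕ a ℕ.<? j) (X a) (Y a)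

splice-zero : ∀ {k} (X Y : Matℤ k) → splice 0 X Y ≋ Y
splice-zero X Y a c with toℕ a ℕ.<? 0
... | no _ = refl

splice-all : ∀ {k} (X Y : Matℤ k) → splice k X Y ≋ X
splice-all {k} X Y a c with toℕ a ℕ.<? k
... | yes _  = refl
... | no a≮k = ⊥-elim (a≮k (FP.toℕ<n a))

splice-congʳ : ∀ {k} j (X : Matℤ k) {Y Y′ : Matℤ k} → Y ≋ Y′ → splice j X Y ≋ splice j X Y′
splice-congʳ j X Y≋Y′ a c with toℕ a ℕ.<? j
... | yes _ = refl
... | no _  = Y≋Y′ a c

splice-suc : ∀ {k} j (X Y : Matℤ k) r → toℕ r ≡ j →
             splice (suc j) X Y ≋ setRow (splice j X Y) r (X r)
splice-suc j X Y r r≡j a c with a FP.≟ r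
... | yes refl = trans (step (toℕ a ℕ.<? suc j)) (sym (cong-app (setRow-same (splice j X Y) a (X a)) c))
  where step : (p : Dec (toℕ a ℕ.< suc j)) → select p (X a) (Y a) c ≡ X a c
        step (yes _)   = refl
        step (no a≮j+1) = ⊥-elim (a≮j+1 (ℕ.s≤s (ℕP.≤-reflexive r≡j)))
... | no a≢r = trans (step (toℕ a ℕ.<? suc j) (toℕ a ℕ.<? j))
                     (sym (cong-app (setRow-other (splice j X Y) (X r) a≢r) c))
  where a≢j : toℕ a ≢ j
        a≢j a≡j = a≢r (FP.toℕ-injective (trans a≡j (sym r≡j)))
        step : (p : Dec (toℕ a ℕ.< suc j)) (q : Dec (toℕ a ℕ.< j)) →
               select p (X a) (Y a) c ≡ select q (X a) (Y a) c
        step (yes _)    (yes _)  = refl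
        step (no _)     (no _)   = refl
        step (yes a<j+1) (no a≮j) = ⊥-elim (a≢j (ℕP.≤-antisym (ℕ.s≤s⁻¹ a<j+1) (ℕP.≮⇒≥ a≮j)))
        step (no a≮j+1) (yes a<j) = ⊥-elim (a≮j+1 (ℕP.m<n⇒m<1+n a<j))

splice-setRow : ∀ {k} j (X Y : Matℤ k) r w → toℕ r ≡ j →
                setRow (splice j X Y) r w ≋ splice j X (setRow Y r w)
splice-setRow j X Y r w r≡j a c with a FP.≟ r
... | yes refl = trans (cong-app (setRow-same (splice j X Y) a w) c) (step (toℕ a ℕ.<? j))
  where step : (p : Dec (toℕ a ℕ.< j)) → w c ≡ select p (X a) (setRow Y a w a) c
        step (yes a<j) = ⊥-elim (ℕP.<-irrefl r≡j a<j)
        step (no _)    = sym (cong-app (setRow-same Y a w) c)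
... | no a≢r = trans (cong-app (setRow-other (splice j X Y) w a≢r) c) (step (toℕ a ℕ.<? j))
  where step : (p : Dec (toℕ a ℕ.< j)) →
               select p (X a) (Y a) c ≡ select p (X a) (setRow Y r w a) c
        step (yes _) = refl
        step (no _)  = sym (cong-app (setRow-other Y w a≢r) c)

-- If d divides det (R ∘ ρ) for every choice ρ of k rows of R (n ≥ 1),
-- then d divides det (A·R).  Induction on the number j of rows of A·R
-- already placed; the next one is expanded by linear-∣.
det-product-∣ : ∀ {k n} (A : Fin k → Fin n → ℤ) (R : Fin n → Row k) d →
  (∀ (ρ : Fin k → Fin n) → d ∣ₛ det k (R ∘ ρ)) → Fin n →
  d ∣ₛ det k (λ a b → sum (λ l → A a l * R l b))
det-product-∣ {k} {n} A R d hyp l₀ =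
  subst (d ∣ₛ_) (det-cong k (splice-all AR (R ∘ const l₀))) (partial k ℕP.≤-refl (const l₀))
  where
  AR : Matℤ k
  AR a b = sum (λ l → A a l * R l b)
  partial : ∀ j → j ℕ.≤ k → ∀ ρ → d ∣ₛ det k (splice j AR (R ∘ ρ))
  partial zero    _   ρ = subst (d ∣ₛ_) (sym (det-cong k (splice-zero AR (R ∘ ρ)))) (hyp ρ)
  partial (suc j) j<k ρ = subst (d ∣ₛ_) (sym (det-cong k (splice-suc j AR (R ∘ ρ) r r≡j)))
    (linear-∣ (det-linear k (splice j AR (R ∘ ρ)) r) d (A r) R (λ l →
      subst (d ∣ₛ_) (sym (det-cong k (λ a c → trans (splice-setRow j AR (R ∘ ρ) r (R l) r≡j a c)
                                                      (splice-congʳ j AR (redirect l) a c))))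
        (partial j (ℕP.<⇒≤ j<k) (updateAt ρ r (const l)))))
    where
    r : Fin k
    r = F.fromℕ< j<k
    r≡j : toℕ r ≡ j
    r≡j = FP.toℕ-fromℕ< j<k
    redirect : ∀ l → setRow (R ∘ ρ) r (R l) ≋ (R ∘ updateAt ρ r (const l))
    redirect l a = cong-app (sym (map-updateAt-local {f = R} {g = const l} {h = const (R l)} ρ r refl a))

·-sum : ∀ {n} (P Q : Matℤ n) i j → (P · Q) i j ≡ sum (λ l → P i l * Q l j)
·-sum {n} P Q i j = sumFin≡sum n (λ l → P i l * Q l j)

≋-setoid : ℕ → Setoid 0ℓ 0ℓ
≋-setoid n = record
  { Carrier       = Matℤ n
  ; _≈_           = _≋_
  ; isEquivalence = record
    { refl  = λ _ _ → refl
    ; sym   = λ P≋Q i j → sym (P≋Q i j)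
    ; trans = λ P≋Q Q≋R i j → trans (P≋Q i j) (Q≋R i j)
    }
  }

·-cong : ∀ {n} {P P′ Q Q′ : Matℤ n} → P ≋ P′ → Q ≋ Q′ → P · Q ≋ P′ · Q′
·-cong {P = P} {P′} {Q} {Q′} P≋P′ Q≋Q′ i j = trans (·-sum P Q i j)
  (trans (sum-cong-≗ (λ l → cong₂ _*_ (P≋P′ i l) (Q≋Q′ l j))) (sym (·-sum P′ Q′ i j)))

·-congˡ : ∀ {n} {P P′ : Matℤ n} (Q : Matℤ n) → P ≋ P′ → P · Q ≋ P′ · Q
·-congˡ Q P≋P′ = ·-cong {Q = Q} P≋P′ (λ _ _ → refl)

·-congʳ : ∀ {n} (P : Matℤ n) {Q Q′ : Matℤ n} → Q ≋ Q′ → P · Q ≋ P · Q′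
·-congʳ P Q≋Q′ = ·-cong {P = P} (λ _ _ → refl) Q≋Q′

·-assoc : ∀ {n} (P Q R : Matℤ n) → (P · Q) · R ≋ P · (Q · R)
·-assoc P Q R i j = begin
  ((P · Q) · R) i j
    ≡⟨ ·-sum (P · Q) R i j ⟩
  sum (λ l → (P · Q) i l * R l j)
    ≡⟨ sum-cong-≗ (λ l → cong (_* R l j) (·-sum P Q i l)) ⟩
  sum (λ l → sum (λ m → P i m * Q m l) * R l j)
    ≡⟨ sum-cong-≗ (λ l → *-distribʳ-sum (R l j) (λ m → P i m * Q m l)) ⟩
  sum (λ l → sum (λ m → P i m * Q m l * R l j))
    ≡⟨ ∑-comm (λ l m → P i m * Q m l * R l j) ⟩
  sum (λ m → sum (λ l → P i m * Q m l * R l j))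
    ≡⟨ sum-cong-≗ (λ m → sum-cong-≗ (λ l → ℤP.*-assoc (P i m) (Q m l) (R l j))) ⟩
  sum (λ m → sum (λ l → P i m * (Q m l * R l j)))
    ≡⟨ sum-cong-≗ (λ m → *-distribˡ-sum (P i m) (λ l → Q m l * R l j)) ⟨
  sum (λ m → P i m * sum (λ l → Q m l * R l j))
    ≡⟨ sum-cong-≗ (λ m → cong (P i m *_) (·-sum Q R m j)) ⟨
  sum (λ m → P i m * (Q · R) m j)
    ≡⟨ ·-sum P (Q · R) i j ⟨
  (P · (Q · R)) i j ∎
  where open ≡-Reasoning

=ᵇ-refl : ∀ {n} (i : Fin n) → (i =ᵇ i) ≡ true
=ᵇ-refl i = trans (isYes≗does (i FP.≟ i)) (dec-true (i FP.≟ i) refl)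

=ᵇ-≢ : ∀ {n} {i j : Fin n} → i ≢ j → (i =ᵇ j) ≡ false
=ᵇ-≢ {i = i} {j} i≢j = trans (isYes≗does (i FP.≟ j)) (dec-false (i FP.≟ j) i≢j)

=ᵇ⇒≡ : ∀ {n} {i j : Fin n} → (i =ᵇ j) ≡ true → i ≡ j
=ᵇ⇒≡ {i = i} {j} i=j = toWitness {a? = i FP.≟ j} (subst T (sym i=j) tt)

Id-entry : ∀ {n} (i j : Fin n) → i ≢ j → Id i j ≡ + 0
Id-entry i j i≢j = cong (if_then + 1 else + 0) (=ᵇ-≢ i≢j)

Id-diag : ∀ {n} (i : Fin n) → Id i i ≡ + 1
Id-diag i = cong (if_then + 1 else + 0) (=ᵇ-refl i)

Id-· : ∀ {n} (M : Matℤ n) → Id · M ≋ M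
Id-· M i j = begin
  (Id · M) i j                ≡⟨ ·-sum Id M i j ⟩
  sum (λ l → Id i l * M l j)  ≡⟨ sum-single (λ l → Id i l * M l j) i off ⟩
  Id i i * M i j              ≡⟨ cong (_* M i j) (Id-diag i) ⟩
  + 1 * M i j                 ≡⟨ ℤP.*-identityˡ (M i j) ⟩
  M i j                       ∎
  where open ≡-Reasoning
        off : ∀ l → l ≢ i → Id i l * M l j ≡ + 0
        off l l≢i = trans (cong (_* M l j) (Id-entry i l (l≢i ∘ sym))) (ℤP.*-zeroˡ (M l j))

·-Id : ∀ {n} (M : Matℤ n) → M · Id ≋ M
·-Id M i j = begin
  (M · Id) i j                ≡⟨ ·-sum M Id i j ⟩
  sum (λ l → M i l * Id l j)  ≡⟨ sum-single (λ l → M i l * Id l j) j off ⟩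
  M i j * Id j j              ≡⟨ cong (M i j *_) (Id-diag j) ⟩
  M i j * + 1                 ≡⟨ ℤP.*-identityʳ (M i j) ⟩
  M i j                       ∎
  where open ≡-Reasoning
        off : ∀ l → l ≢ j → M i l * Id l j ≡ + 0
        off l l≢j = trans (cong (M i l *_) (Id-entry l j l≢j)) (ℤP.*-zeroʳ (M i l))

unimodular-undo : ∀ {n} (C D P P′ Q Q′ : Matℤ n) → IsInverse P P′ → IsInverse Q Q′ →
                  (∀ i j → ((P · C) · Q) i j ≡ D i j) → C ≋ P′ · (D · Q′)
unimodular-undo C D P P′ Q Q′ (_ , P′P≡Id) (QQ′≡Id , _) PCQ≡D = begin
  C                               ≈⟨ Id-· C ⟨
  Id · C                          ≈⟨ ·-congˡ C (λ i j → sym (P′P≡Id i j)) ⟩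
  (P′ · P) · C                    ≈⟨ ·-assoc P′ P C ⟩
  P′ · (P · C)                    ≈⟨ ·-Id (P′ · (P · C)) ⟨
  (P′ · (P · C)) · Id             ≈⟨ ·-congʳ (P′ · (P · C)) (λ i j → sym (QQ′≡Id i j)) ⟩
  (P′ · (P · C)) · (Q · Q′)       ≈⟨ ·-assoc P′ (P · C) (Q · Q′) ⟩
  P′ · ((P · C) · (Q · Q′))       ≈⟨ ·-congʳ P′ (·-assoc (P · C) Q Q′) ⟨
  P′ · (((P · C) · Q) · Q′)       ≈⟨ ·-congʳ P′ (·-congˡ Q′ PCQ≡D) ⟩
  P′ · (D · Q′)                   ∎
  where open SetoidReasoning (≋-setoid _)

smith-chain : ∀ {n} {D : Matℤ n} → IsSmithForm D →
              ∀ t (i j : Fin n) → toℕ j ≡ t ℕ.+ toℕ i → D i i ∣ₛ D j j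
smith-chain {D = D} sf zero    i j j≡i = subst (λ x → D i i ∣ₛ D x x) (FP.toℕ-injective (sym j≡i)) ℤS.∣-refl
smith-chain {n} {D} sf@(_ , _ , adjacent) (suc t) i j gap =
  ℤS.∣-trans (smith-chain sf t i j′ j′-gap) (ℤS.∣ᵤ⇒∣ (adjacent j′ j (trans gap (cong suc (sym j′-gap)))))
  where
  j′<n : t ℕ.+ toℕ i ℕ.< n
  j′<n = ℕP.<-trans (subst (t ℕ.+ toℕ i ℕ.<_) (sym gap) (ℕP.n<1+n _)) (FP.toℕ<n j)
  j′ : Fin n
  j′ = F.fromℕ< j′<n
  j′-gap : toℕ j′ ≡ t ℕ.+ toℕ i
  j′-gap = FP.toℕ-fromℕ< j′<n

-- C = P′ (D Q′), and the rows of D Q′ are multiples d_l of rows of Q′;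
-- by det-product-∣ it suffices that d_i divides det of any k = i+1 of
-- these rows: either two coincide, or one has index l ≥ i and d_i ∣ d_l.
smith-∣-minors : ∀ {n} (C D : Matℤ n) → IsSNFOf D C → ∀ (i : Fin n) rs cs →
                 D i i ∣ₛ det (suc (toℕ i)) (submatrix C rs cs)
smith-∣-minors {n} C D (P , P′ , Q , Q′ , invP , invQ , sf@(offdiag , _ , _) , PCQ≡D) i rs cs =
  subst (D i i ∣ₛ_) (sym (det-cong k as-product))
    (det-product-∣ (λ a l → P′ (lookup rs a) l) R (D i i) rows-of-N i)
  where
  k : ℕ
  k = suc (toℕ i)
  N : Matℤ n
  N = D · Q′
  N-row : ∀ l c → N l c ≡ D l l * Q′ l c
  N-row l c = trans (·-sum D Q′ l c) (sum-single (λ m → D l m * Q′ m c) l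
    (λ m m≢l → trans (cong (_* Q′ m c) (offdiag l m (m≢l ∘ sym))) (ℤP.*-zeroˡ (Q′ m c))))
  R : Fin n → Row k
  R l b = N l (lookup cs b)
  as-product : submatrix C rs cs ≋ (λ a b → sum (λ l → P′ (lookup rs a) l * R l b))
  as-product a b = trans (unimodular-undo C D P P′ Q Q′ invP invQ PCQ≡D (lookup rs a) (lookup cs b))
                         (·-sum P′ N (lookup rs a) (lookup cs b))
  -- k rows of N all of index < i repeat a row; a row of index ≥ i is divisible by d_i
  rows-of-N : ∀ (ρ : Fin k → Fin n) → D i i ∣ₛ det k (R ∘ ρ)
  rows-of-N ρ with FP.all? (λ a → toℕ (ρ a) ℕ.<? toℕ i)
  ... | yes all< = divides (+ 0) (trans (det-cong k repeat) (det-few-rows (ℕP.n<1+n (toℕ i)) f (R ∘ embed)))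
    where
    i≤n : toℕ i ℕ.≤ n
    i≤n = ℕP.<⇒≤ (FP.toℕ<n i)
    embed : Fin (toℕ i) → Fin n
    embed x = F.inject≤ x i≤n
    f : Fin k → Fin (toℕ i)
    f a = F.fromℕ< (all< a)
    repeat : R ∘ ρ ≋ R ∘ embed ∘ f
    repeat a c = cong (λ x → R x c) (FP.toℕ-injective
      (sym (trans (FP.toℕ-inject≤ (f a) i≤n) (FP.toℕ-fromℕ< (all< a)))))
  ... | no ¬all< with FP.¬∀⟶∃¬ k (λ a → toℕ (ρ a) ℕ.< toℕ i) (λ a → toℕ (ρ a) ℕ.<? toℕ i) ¬all<
  ...   | a , ρa≮i = det-row-∣ k (R ∘ ρ) a (D i i) (λ b →
            subst (D i i ∣ₛ_) (sym (N-row (ρ a) (lookup cs b)))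
              (ℤS.∣m⇒∣m*n (Q′ (ρ a) (lookup cs b)) (smith-chain sf _ i (ρ a) ρa≡)))
    where ρa≡ : toℕ (ρ a) ≡ (toℕ (ρ a) ℕ.∸ toℕ i) ℕ.+ toℕ i
          ρa≡ = sym (trans (ℕP.+-comm _ (toℕ i)) (ℕP.m+[n∸m]≡n (ℕP.≮⇒≥ ρa≮i)))

gcdList : List ℤ → ℕ
gcdList = foldr (λ a g → gcd ℤ.∣ a ∣ g) 0

combination : List ℤ → List ℤ → ℤ
combination ws as = foldr _+_ (+ 0) (zipWith _*_ ws as)

gcdList-∣ : ∀ L → All (λ a → gcdList L ℕD.∣ ℤ.∣ a ∣) L
gcdList-∣ []      = []
gcdList-∣ (a ∷ L) = gcd[m,n]∣m ℤ.∣ a ∣ (gcdList L)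
  ∷ All.map (ℕD.∣-trans (gcd[m,n]∣n ℤ.∣ a ∣ (gcdList L))) (gcdList-∣ L)

gcdList-greatest : ∀ g L → All (λ a → g ℕD.∣ ℤ.∣ a ∣) L → g ℕD.∣ gcdList L
gcdList-greatest g []      []         = ℕD.divides 0 refl
gcdList-greatest g (a ∷ L) (g∣a ∷ g∣L) = gcd-greatest g∣a (gcdList-greatest g L g∣L)

combination-∣ : ∀ d L → All (d ∣ₛ_) L → ∀ ws → d ∣ₛ combination ws L
combination-∣ d []      []          []       = divides (+ 0) refl
combination-∣ d []      []          (w ∷ ws) = divides (+ 0) refl
combination-∣ d (a ∷ L) (d∣a ∷ d∣L) []       = divides (+ 0) refl
combination-∣ d (a ∷ L) (d∣a ∷ d∣L) (w ∷ ws) =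
  ℤS.∣m∣n⇒∣m+n (ℤS.∣n⇒∣m*n w d∣a) (combination-∣ d L d∣L ws)

combination-scale : ∀ s ws L → combination (List.map (s *_) ws) L ≡ s * combination ws L
combination-scale s []       L       = sym (ℤP.*-zeroʳ s)
combination-scale s (w ∷ ws) []      = sym (ℤP.*-zeroʳ s)
combination-scale s (w ∷ ws) (a ∷ L) =
  trans (cong₂ _+_ (ℤP.*-assoc s w a) (combination-scale s ws L))
        (sym (ℤP.*-distribˡ-+ s (w * a) (combination ws L)))

pos-identity : ∀ a b c e f → a ℕ.+ b ℕ.* c ≡ e ℕ.* f → + a + + b * + c ≡ + e * + f
pos-identity a b c e f eq = trans (cong (λ t → + a + t) (sym (ℤP.pos-* b c)))
  (trans (sym (ℤP.pos-+ a (b ℕ.* c))) (trans (cong +_ eq) (ℤP.pos-* e f)))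

bezoutℤ : ∀ m n → Σ ℤ λ x → Σ ℤ λ y → x * + m + y * + n ≡ + gcd m n
bezoutℤ m n with Bézout.identity (gcd-GCD m n)
... | Bézout.+- x y eq = + x , - + y , (begin
  + x * + m + (- + y) * + n              ≡⟨ cong (λ t → t + (- + y) * + n) (pos-identity (gcd m n) y n x m eq) ⟨
  + gcd m n + + y * + n + (- + y) * + n  ≡⟨ cancel (+ gcd m n) (+ y) (+ n) ⟩
  + gcd m n                              ∎)
  where open ≡-Reasoning
        cancel : ∀ d y n → d + y * n + (- y) * n ≡ d
        cancel = solve-∀
... | Bézout.-+ x y eq = - + x , + y , (begin
  (- + x) * + m + + y * + n              ≡⟨ cong (λ t → (- + x) * + m + t) (pos-identity (gcd m n) x m y n eq) ⟨
  (- + x) * + m + (+ gcd m n + + x * + m) ≡⟨ cancel (+ gcd m n) (+ x) (+ m) ⟩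
  + gcd m n                              ∎)
  where open ≡-Reasoning
        cancel : ∀ d x m → (- x) * m + (d + x * m) ≡ d
        cancel = solve-∀

abs-multiple : ∀ a → Σ ℤ λ s → s * a ≡ + ℤ.∣ a ∣
abs-multiple (+ n)      = + 1 , ℤP.*-identityˡ (+ n)
abs-multiple ℤ.-[1+ n ] = ℤ.-1ℤ , ℤP.-1*i≡-i ℤ.-[1+ n ]

gcdList-bezout : ∀ L → Σ (List ℤ) λ ws → combination ws L ≡ + gcdList L
gcdList-bezout []      = [] , refl
gcdList-bezout (a ∷ L) with gcdList-bezout L | abs-multiple a | bezoutℤ ℤ.∣ a ∣ (gcdList L)
... | ws , ws·L≡g | s , s·a≡∣a∣ | x , y , bezout = (x * s) ∷ List.map (y *_) ws , (begin
  (x * s) * a + combination (List.map (y *_) ws) L  ≡⟨ cong₂ _+_ (ℤP.*-assoc x s a) (combination-scale y ws L) ⟩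
  x * (s * a) + y * combination ws L               ≡⟨ cong₂ (λ p q → x * p + y * q) s·a≡∣a∣ ws·L≡g ⟩
  x * + ℤ.∣ a ∣ + y * + gcdList L                  ≡⟨ bezout ⟩
  + gcdList (a ∷ L)                                ∎)
  where open ≡-Reasoning

combination⇔gcd-∣ : ∀ L z → (Σ (List ℤ) λ ws → combination ws L ≡ z) ⇔ (+ gcdList L ∣ z)
combination⇔gcd-∣ L z = mk⇔ to from
  where
  to : (Σ (List ℤ) λ ws → combination ws L ≡ z) → + gcdList L ∣ z
  to (ws , ws·L≡z) = ℤS.∣⇒∣ᵤ (subst (+ gcdList L ∣ₛ_) ws·L≡z
    (combination-∣ (+ gcdList L) L (All.map ℤS.∣ᵤ⇒∣ (gcdList-∣ L)) ws))
  from : + gcdList L ∣ z → Σ (List ℤ) λ ws → combination ws L ≡ z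
  from g∣z with ℤS.∣ᵤ⇒∣ g∣z | gcdList-bezout L
  ... | divides q z≡qg | ws , ws·L≡g = List.map (q *_) ws ,
    trans (combination-scale q ws L) (trans (cong (q *_) ws·L≡g) (sym z≡qg))

-- Evaluation at a point is a ring
-- homomorphism, so it commutes with determinants; the generators of I_k
-- evaluate to the k × k minors of the evaluated generalized Laplacian.

module DetPoly {m : ℕ} = Det {Poly m} (con (+ 0)) (con (+ 1)) _⊕_ _⊗_ ⊖_

eval-sum : ∀ {m} (x : Fin m → ℤ) n (f : Fin n → Poly m) →
           eval x (sumFin (con (+ 0)) _⊕_ n f) ≡ sum (eval x ∘ f)
eval-sum x zero    f = refl
eval-sum x (suc n) f = cong (λ s → eval x (f zero) + s) (eval-sum x n (f ∘ suc))

eval-alt : ∀ {m} (x : Fin m → ℤ) k (p : Poly m) → eval x (DetPoly.alt k p) ≡ Detℤ.alt k (eval x p)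
eval-alt x zero    p = refl
eval-alt x (suc k) p = cong -_ (eval-alt x k p)

eval-det : ∀ {m} (x : Fin m → ℤ) k (M : Fin k → Fin k → Poly m) →
           eval x (DetPoly.det k M) ≡ det k (λ r c → eval x (M r c))
eval-det x zero    M = refl
eval-det x (suc k) M = begin
  eval x (DetPoly.det (suc k) M)            ≡⟨ eval-sum x (suc k) term ⟩
  sum (eval x ∘ term)                       ≡⟨ sum-cong-≗ term-eval ⟩
  sum evaluated                             ≡⟨ sumFin≡sum (suc k) evaluated ⟨
  det (suc k) (λ r c → eval x (M r c))      ∎
  where
  open ≡-Reasoning
  term : Fin (suc k) → Poly _
  term j = DetPoly.alt (toℕ j) (M zero j ⊗ DetPoly.det k (λ r c → M (suc r) (punchIn j c)))
  evaluated : Fin (suc k) → ℤ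
  evaluated j = Detℤ.alt (toℕ j) (eval x (M zero j) * det k (λ r c → eval x (M (suc r) (punchIn j c))))
  term-eval : ∀ j → eval x (term j) ≡ evaluated j
  term-eval j = trans (eval-alt x (toℕ j) _)
    (cong (λ d → Detℤ.alt (toℕ j) (eval x (M zero j) * d)) (eval-det x k (λ r c → M (suc r) (punchIn j c))))

eval-lincomb : ∀ {m} (x : Fin m → ℤ) cs gs →
               eval x (lincomb cs gs) ≡ combination (List.map (eval x) cs) (List.map (eval x) gs)
eval-lincomb x []       gs       = refl
eval-lincomb x (c ∷ cs) []       = refl
eval-lincomb x (c ∷ cs) (g ∷ gs) = cong (λ s → eval x c * eval x g + s) (eval-lincomb x cs gs)

generators-eval : ∀ {n} (A : Fin n → Fin n → ℕ) (x : Fin n → ℤ) (C : Matℤ n) →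
  (∀ i j → eval x (Lap A i j) ≡ C i j) → ∀ k →
  List.map (eval x) (criticalGens A k) ≡ minorsℤ n k C
generators-eval {n} A x C Lap≡C k = begin
  List.map (eval x) (List.concat (List.map rowMinors (choose k n)))
    ≡⟨ LP.map-concatMap (eval x) rowMinors (choose k n) ⟩
  List.concat (List.map (List.map (eval x) ∘ rowMinors) (choose k n))
    ≡⟨ cong List.concat (LP.map-cong (λ rs → trans (sym (LP.map-∘ (choose k n)))
         (LP.map-cong (λ cs → trans (eval-det x k (submatrix (Lap A) rs cs))
                                    (det-cong k (λ a b → Lap≡C (lookup rs a) (lookup cs b))))
           (choose k n))) (choose k n)) ⟩
  minorsℤ n k C ∎
  where
  open ≡-Reasoning
  rowMinors : _ → List (Poly n)
  rowMinors rs = List.map (λ cs → DetPoly.det k (submatrix (Lap A) rs cs)) (choose k n)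

critical-ideal-eval : ∀ {n} (A : Fin n → Fin n → ℕ) (x : Fin n → ℤ) (C : Matℤ n) →
  (∀ i j → eval x (Lap A i j) ≡ C i j) → ∀ k z →
  (z ∈Ieval[ k , x ] A) ⇔ (+ Δ k C ∣ z)
critical-ideal-eval {n} A x C Lap≡C k z = mk⇔
  (λ ev → Equivalence.to (combination⇔gcd-∣ kMinors z) (to ev))
  (λ Δ∣z → from (Equivalence.from (combination⇔gcd-∣ kMinors z) Δ∣z))
  where
  gens : List (Poly n)
  gens = criticalGens A k
  kMinors : List ℤ
  kMinors = minorsℤ n k C
  gens≡kMinors : List.map (eval x) gens ≡ kMinors
  gens≡kMinors = generators-eval A x C Lap≡C k
  to : z ∈Ieval[ k , x ] A → Σ (List ℤ) λ ws → combination ws kMinors ≡ z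
  to (p , (cs , p≈) , p[x]≡z) = List.map (eval x) cs , (begin
    combination (List.map (eval x) cs) kMinors
      ≡⟨ cong (combination (List.map (eval x) cs)) gens≡kMinors ⟨
    combination (List.map (eval x) cs) (List.map (eval x) gens)  ≡⟨ eval-lincomb x cs gens ⟨
    eval x (lincomb cs gens)                                     ≡⟨ p≈ x ⟨
    eval x p                                                     ≡⟨ p[x]≡z ⟩
    z                                                            ∎)
    where open ≡-Reasoning
  -- an integral combination of the minors lifts with constant coefficients
  from : (Σ (List ℤ) λ ws → combination ws kMinors ≡ z) → z ∈Ieval[ k , x ] A
  from (ws , ws·kMinors≡z) = lincomb cs gens , (cs , λ _ → refl) , (begin
    eval x (lincomb cs gens)                                     ≡⟨ eval-lincomb x cs gens ⟩
    combination (List.map (eval x) cs) (List.map (eval x) gens)  ≡⟨ cong₂ combination consts gens≡kMinors ⟩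
    combination ws kMinors                                       ≡⟨ ws·kMinors≡z ⟩
    z                                                            ∎)
    where
    open ≡-Reasoning
    cs : List (Poly n)
    cs = List.map con ws
    consts : List.map (eval x) cs ≡ ws
    consts = trans (sym (LP.map-∘ ws)) (LP.map-id ws)

smith-∣-Δ : ∀ {n} (C D : Matℤ n) → IsSNFOf D C → ∀ (i : Fin n) →
            ℤ.∣ D i i ∣ ℕD.∣ Δ (suc (toℕ i)) C
smith-∣-Δ {n} C D snf i = gcdList-greatest ℤ.∣ D i i ∣ (minorsℤ n k C)
  (AllP.concat⁺ (AllP.map⁺ (All.universal (λ rs → AllP.map⁺ (All.universal (λ cs →
    ℤS.∣⇒∣ᵤ (smith-∣-minors C D snf i rs cs)) (choose k n))) (choose k n))))
  where k : ℕ
        k = suc (toℕ i)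

-- if Δ_{i+1}(C) = 1 then d_i = 1 (d_i ≥ 0 in a Smith form)
unit-invariant-factor : ∀ {n} (C D : Matℤ n) → IsSNFOf D C → ∀ (i : Fin n) →
                        Δ (suc (toℕ i)) C ℕD.∣ 1 → D i i ≡ + 1
unit-invariant-factor C D snf@(_ , _ , _ , _ , _ , _ , (_ , D≥0 , _) , _) i Δ∣1 =
  nonneg-unit (D i i) (D≥0 i) (ℕD.∣1⇒≡1 (ℕD.∣-trans (smith-∣-Δ C D snf i) Δ∣1))
  where nonneg-unit : ∀ x → ℤ.0ℤ ℤ.≤ x → ℤ.∣ x ∣ ≡ 1 → x ≡ + 1
        nonneg-unit (+ n) _ ∣x∣≡1 = cong +_ ∣x∣≡1

count-≥ : ∀ n (T : Subset n) (p : Fin n → Bool) → (∀ i → i ∈ T → p i ≡ true) → ∣ T ∣ ≤ count n p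
count-≥ zero    Vec.[]           p T⊆p = ℕ.z≤n
count-≥ (suc n) (true Vec.∷ T)   p T⊆p rewrite T⊆p zero here =
  ℕ.s≤s (count-≥ n T (p ∘ suc) (λ i i∈T → T⊆p (suc i) (there i∈T)))
count-≥ (suc n) (false Vec.∷ T)  p T⊆p = ℕP.≤-trans (count-≥ n T (p ∘ suc) (λ i i∈T → T⊆p (suc i) (there i∈T)))
  (ℕP.m≤n+m _ (if p zero then 1 else 0))

-- The weak dual.  Every edge separates two faces, distinct unless both
-- are the outer face, so an interior face is never on both sides of an edge.

Exclusive : Bool → Bool → Set
Exclusive x y = x ≡ true → y ≡ true → ⊥

-- with a = [s₁ = i], b = [s₂ = j], c = [s₁ = j], d = [s₂ = i]: an edge is a
-- dual edge between i and j iff it bounds both faces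
dual-edge-test : ∀ a b c d → Exclusive a c → Exclusive b d → Exclusive a d → Exclusive c b →
                 ((a ∧ b) ∨ (c ∧ d)) ≡ ((a ∨ d) ∧ (c ∨ b))
dual-edge-test true  _     true  _     a#c _   _   _   = ⊥-elim (a#c refl refl)
dual-edge-test true  _     false true  _   _   a#d _   = ⊥-elim (a#d refl refl)
dual-edge-test true  true  false false _   _   _   _   = refl
dual-edge-test true  false false false _   _   _   _   = refl
dual-edge-test false true  _     true  _   b#d _   _   = ⊥-elim (b#d refl refl)
dual-edge-test false true  true  false _   _   _   c#b = ⊥-elim (c#b refl refl)
dual-edge-test false true  false false _   _   _   _   = refl
dual-edge-test false false true  true  _   _   _   _   = refl
dual-edge-test false false true  false _   _   _   _   = refl
dual-edge-test false false false true  _   _   _   _   = refl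
dual-edge-test false false false false _   _   _   _   = refl

count-cong : ∀ m (p q : Fin m → Bool) → (∀ e → p e ≡ q e) → count m p ≡ count m q
count-cong zero    p q p≗q = refl
count-cong (suc m) p q p≗q = cong₂ ℕ._+_ (cong (if_then 1 else 0) (p≗q zero))
  (count-cong m (p ∘ suc) (q ∘ suc) (p≗q ∘ suc))

count-none : ∀ m (p : Fin m → Bool) → (∀ e → p e ≡ false) → count m p ≡ 0
count-none zero    p none = refl
count-none (suc m) p none = cong₂ ℕ._+_ (cong (if_then 1 else 0) (none zero))
  (count-none m (p ∘ suc) (none ∘ suc))

module WeakDual {V m n : ℕ} (H : PlaneGraph V m n) where
  open PlaneGraph H

  interior-one-side : ∀ e i → side₁ e ≡ suc i → side₂ e ≡ suc i → ⊥
  interior-one-side e i s₁≡i s₂≡i with trans (sym s₁≡i) (separating e (trans s₁≡i (sym s₂≡i)))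
  ... | ()

  adjacency-diag : ∀ i → weakDualAdj i i ≡ 0
  adjacency-diag i = count-none m _ (λ e → no-loop (side₁ e =ᵇ suc i) (side₂ e =ᵇ suc i)
    (λ s₁ s₂ → interior-one-side e i (=ᵇ⇒≡ s₁) (=ᵇ⇒≡ s₂)))
    where no-loop : ∀ x y → Exclusive x y → ((x ∧ y) ∨ (x ∧ y)) ≡ false
          no-loop true  true  x#y = ⊥-elim (x#y refl refl)
          no-loop true  false _   = refl
          no-loop false _     _   = refl

  adjacency-common : ∀ i j → i ≢ j → weakDualAdj i j ≡ common i j
  adjacency-common i j i≢j = count-cong m _ _ (λ e → dual-edge-test
    (side₁ e =ᵇ suc i) (side₂ e =ᵇ suc j) (side₁ e =ᵇ suc j) (side₂ e =ᵇ suc i)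
    (λ x y → i≢j (FP.suc-injective (trans (sym (=ᵇ⇒≡ x)) (=ᵇ⇒≡ y))))
    (λ x y → i≢j (FP.suc-injective (trans (sym (=ᵇ⇒≡ y)) (=ᵇ⇒≡ x))))
    (λ x y → interior-one-side e i (=ᵇ⇒≡ x) (=ᵇ⇒≡ y))
    (λ x y → interior-one-side e j (=ᵇ⇒≡ x) (=ᵇ⇒≡ y)))

  laplacian-at-c : ∀ i j → eval cvec (Lap weakDualAdj i j) ≡ cycleIntersection i j
  laplacian-at-c i j with i FP.≟ j
  ... | yes refl rewrite adjacency-diag i = ℤP.+-identityʳ (+ faceLength i)
  ... | no i≢j   rewrite adjacency-common i j i≢j = refl

-- The theorem.  (1) is critical-ideal-eval at the face lengths; for (2),
-- each i ∈ T has I_{i+1}(G) = ⟨1⟩, so 1 = Δ_{i+1}(C) generates the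
-- evaluated ideal and d_i = 1 is counted by f₁.
mainTheorem1 : ∀ {V m n : ℕ} (H : PlaneGraph V m n) →
    (∀ (k : ℕ) (z : ℤ) →
       (z ∈Ieval[ k , PlaneGraph.cvec H ] PlaneGraph.weakDualAdj H)
         ⇔ ((+ Δ k (PlaneGraph.cycleIntersection H)) ∣ z)) ×
    (∀ (D : Matℤ n) → IsSNFOf D (PlaneGraph.cycleIntersection H) →
       ∀ (T : Subset n) →
         (∀ i → i ∈ T → IsTrivialIdeal (suc (toℕ i)) (PlaneGraph.weakDualAdj H)) →
         ∣ T ∣ ≤ f₁ D)
mainTheorem1 {n = n} H = evaluated-ideal , unit-factors
  where
  open PlaneGraph H using (weakDualAdj; cvec; cycleIntersection)
  evaluated-ideal : ∀ k z → (z ∈Ieval[ k , cvec ] weakDualAdj) ⇔ (+ Δ k cycleIntersection ∣ z)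
  evaluated-ideal = critical-ideal-eval weakDualAdj cvec cycleIntersection (WeakDual.laplacian-at-c H)
  unit-factors : ∀ D → IsSNFOf D cycleIntersection → ∀ T →
    (∀ i → i ∈ T → IsTrivialIdeal (suc (toℕ i)) weakDualAdj) → ∣ T ∣ ≤ f₁ D
  unit-factors D snf T trivial = count-≥ n T (λ i → ⌊ D i i ℤ.≟ + 1 ⌋) (λ i i∈T →
    counted i (unit-invariant-factor cycleIntersection D snf i (Δ∣1 i i∈T)))
    where
    Δ∣1 : ∀ i → i ∈ T → Δ (suc (toℕ i)) cycleIntersection ℕD.∣ 1
    Δ∣1 i i∈T = Equivalence.to (evaluated-ideal (suc (toℕ i)) (+ 1)) (con (+ 1) , trivial i i∈T , refl)
    counted : ∀ i → D i i ≡ + 1 → ⌊ D i i ℤ.≟ + 1 ⌋ ≡ true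
    counted i dᵢ≡1 = trans (isYes≗does (D i i ℤ.≟ + 1)) (dec-true (D i i ℤ.≟ + 1) dᵢ≡1)
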